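{- Let $w\in S_\infty$ and $i\geq1$ be such that for all $j\geq1$, $i<j\iff w(i)<w(j)$. Then in any pipe dream $D$ for $w$, the pipe entering from the North in column $i$ passes only through elbow tiles (no cross tiles), exiting at row $w(i)$. Consequently, if $w\in S_n$ and $D$ is a pipe dream for $w$, then $D$ has no cross tiles outside the triangle $\{(a,b): a+b\leq n\}$.
   Context: Squares of the southeast quadrant are indexed by matrix coordinates $(a,b)$, $a,b\geq1$ (row $a$, column $b$). A pipe dream is a filling of these squares with finitely many cross tiles and otherwise elbow tiles (an elbow tile joins its North edge to its West edge and its South edge to its East edge), such that no two pipes cross each other more than once. The pipe entering from the top in column $k$ is the $k$-pipe; $D$ is a pipe dream for $w\in S_\infty$ if for every row $r$ the pipe exiting the left side in row $r$ is the $w(r)$-pipe. $S_n\subset S_\infty$ consists of permutations fixing all integers $>n$. -}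

module Defs where

open import Data.Nat using (ℕ; zero; suc; _+_; _≤_; _<_)
open import Data.Product using (Σ; _×_; _,_; ∃)
open import Data.List using (List; []; _∷_)
open import Data.List.Membership.Propositional using (_∈_)
open import Relation.Binary.PropositionalEquality using (_≡_)
open import Relation.Nullary using (¬_)

-- Squares are indexed by matrix coordinates (a , b), a,b ≥ 1.
-- Index 0 is used only for "off the board" (column 0 = exited on the left).
Square : Set
Square = ℕ × ℕ

data Tile : Set where
  cross elbow : Tile

-- A filling of the quadrant: the tile at row a, column b (values at
-- a = 0 or b = 0 are irrelevant and never consulted).
Filling : Set
Filling = ℕ → ℕ → Tile

FinitelyManyCrosses : Filling → Set
FinitelyManyCrosses D =
  ∃ λ N → ∀ a b → 1 ≤ a → 1 ≤ b → D a b ≡ cross → (a ≤ N × b ≤ N)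

data Dir : Set where
  fromN fromE : Dir

-- Run D a b d vs r : the pipe entering square (a , b) through its d-edge
-- visits exactly the squares vs (in order) and exits the left side of the
-- quadrant in row r.  An elbow joins North↔West and South↔East; a cross
-- joins North↔South and East↔West.
data Run (D : Filling) : ℕ → ℕ → Dir → List Square → ℕ → Set where
  exit    : ∀ {a} → Run D a 0 fromE [] a
  n-cross : ∀ {a b vs r} → D a (suc b) ≡ cross →
            Run D (suc a) (suc b) fromN vs r →
            Run D a (suc b) fromN ((a , suc b) ∷ vs) r
  n-elbow : ∀ {a b vs r} → D a (suc b) ≡ elbow →
            Run D a b fromE vs r →
            Run D a (suc b) fromN ((a , suc b) ∷ vs) r
  e-cross : ∀ {a b vs r} → D a (suc b) ≡ cross →
            Run D a b fromE vs r →
            Run D a (suc b) fromE ((a , suc b) ∷ vs) r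
  e-elbow : ∀ {a b vs r} → D a (suc b) ≡ elbow →
            Run D (suc a) (suc b) fromN vs r →
            Run D a (suc b) fromE ((a , suc b) ∷ vs) r

PipeRun : Filling → ℕ → List Square → ℕ → Set
PipeRun D k vs r = Run D 1 k fromN vs r

tileAt : Filling → Square → Tile
tileAt D (a , b) = D a b

-- No two (distinct) pipes cross each other more than once: two distinct
-- pipes cross at a cross tile exactly when both pass through it.
Reduced : Filling → Set
Reduced D = ∀ {j k vsj vsk rj rk} → 1 ≤ j → 1 ≤ k → ¬ (j ≡ k) →
  PipeRun D j vsj rj → PipeRun D k vsk rk →
  ∀ {s t} → s ∈ vsj → s ∈ vsk → tileAt D s ≡ cross →
            t ∈ vsj → t ∈ vsk → tileAt D t ≡ cross → s ≡ t

-- Permutations of the positive integers with finite support (S_∞).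
-- Convention: represented on ℕ with 0 ↦ 0.
record Perm∞ : Set where
  field
    fun     : ℕ → ℕ
    inv     : ℕ → ℕ
    fun-inv : ∀ m → fun (inv m) ≡ m
    inv-fun : ∀ m → inv (fun m) ≡ m
    fun-0   : fun 0 ≡ 0
    finSupp : ∃ λ N → ∀ m → N < m → fun m ≡ m
open Perm∞ public

InS : ℕ → Perm∞ → Set
InS n w = ∀ m → n < m → fun w m ≡ m

PipeDreamFor : Perm∞ → Filling → Set
PipeDreamFor w D =
  FinitelyManyCrosses D × Reduced D ×
  (∀ r → 1 ≤ r → ∃ λ vs → PipeRun D (fun w r) vs r)

module Submission where

-- Follow a pipe state by state: each step lowers the level b - a of its square by one, so two
-- pipes seen at equal level sit on one diagonal and can be compared by height. They keep their
-- order while they share no cross, and a common cross swaps it. Reading a pipe backwards is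
-- deterministic, so a pipe is determined by its exit row and its level.
--
-- The separation i < j ⇔ w(i) < w(j) forces w(i) = i. If the i-pipe met a cross, the other
-- strand of that cross leaves at some row r, whose pipe k = w(r) must then pass through the
-- same cross. Being reduced, the i- and k-pipes cross only there, so their exit rows i and r
-- are ordered opposite to i and k, against the separation. For w ∈ S_n every i > n separates,
-- and an all-elbow pipe from column i is the staircase through every square with a + b = i.

open import Defs
open import Data.Nat using (ℕ; zero; suc; _+_; _≤_; _<_; z≤n; s≤s; s≤s⁻¹; _<?_)
open import Data.Nat.Properties
open import Algebra.Properties.CommutativeSemigroup +-commutativeSemigroup using (xy∙z≈xz∙y)
open import Data.Product using (_×_; ∃; ∃₂; _,_; proj₁)
open import Data.Sum using (_⊎_; inj₁; inj₂)
open import Data.List using (List; []; _∷_; length)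
open import Data.List.Membership.Propositional using (_∈_; _∉_)
open import Data.List.Relation.Unary.Any using (here; there)
open import Data.List.Relation.Unary.All using (All; _∷_)
import Data.List.Relation.Unary.All as All
open import Data.Fin using (Fin; toℕ; fromℕ<)
open import Data.Fin.Properties using (toℕ-fromℕ<; toℕ-injective; toℕ≤pred[n]; injective⇒≤)
open import Data.Empty using (⊥; ⊥-elim)
open import Function using (id)
open import Function.Bundles using (_⇔_; mk⇔; Equivalence)
open import Relation.Binary using (Tri; tri<; tri≈; tri>)
open import Relation.Binary.PropositionalEquality
open import Relation.Nullary using (¬_; yes; no)

-- A state (a , b , d) of a run enters square (a , b) from side d. Every step lowers its
-- level b - a by one; levels are compared without subtraction (b₁ + a₂ ≡ b₂ + a₁).
-- The entry edges of states of equal level lie on one diagonal line, and Above compares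
-- their heights (the North edge of a square lies above its East edge).
data Above : ℕ → Dir → ℕ → Dir → Set where
  row< : ∀ {a a' d d'} → a < a' → Above a d a' d'
  N-E  : ∀ {a} → Above a fromN a fromE

above-from-north : ∀ {a a'} → a < a' → Above (suc a) fromN a' fromE
above-from-north p with m≤n⇒m<n∨m≡n p
... | inj₁ q    = row< q
... | inj₂ refl = N-E

above-trans : ∀ {a a₁ a' d₁ d'} → Above a fromN a₁ d₁ → Above a₁ fromN a' d' → Above a fromN a' d'
above-trans N-E     q        = q
above-trans (row< p) (row< q) = row< (<-trans p q)
above-trans (row< p) N-E      = row< p

equal-levels⇒equal-lengths : ∀ {ℓ₁ ℓ₂ a₁ a₂ b₁ b₂ r} → ℓ₁ + a₁ ≡ b₁ + r → ℓ₂ + a₂ ≡ b₂ + r →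
                             b₁ + a₂ ≡ b₂ + a₁ → ℓ₁ ≡ ℓ₂
equal-levels⇒equal-lengths {ℓ₁} {ℓ₂} {a₁} {a₂} {b₁} {b₂} {r} e₁ e₂ lvl =
  +-cancelʳ-≡ (a₁ + a₂) ℓ₁ ℓ₂ (begin
    ℓ₁ + (a₁ + a₂)  ≡⟨ +-assoc ℓ₁ a₁ a₂ ⟨
    ℓ₁ + a₁ + a₂    ≡⟨ cong (_+ a₂) e₁ ⟩
    b₁ + r + a₂     ≡⟨ xy∙z≈xz∙y b₁ r a₂ ⟩
    b₁ + a₂ + r     ≡⟨ cong (_+ r) lvl ⟩
    b₂ + a₁ + r     ≡⟨ xy∙z≈xz∙y b₂ a₁ r ⟩
    b₂ + r + a₁     ≡⟨ cong (_+ a₁) e₂ ⟨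
    ℓ₂ + a₂ + a₁    ≡⟨ +-assoc ℓ₂ a₂ a₁ ⟩
    ℓ₂ + (a₂ + a₁)  ≡⟨ cong (ℓ₂ +_) (+-comm a₂ a₁) ⟩
    ℓ₂ + (a₁ + a₂)  ∎)
  where open ≡-Reasoning

other : Dir → Dir
other fromN = fromE
other fromE = fromN

other-≢ : ∀ d → d ≢ other d
other-≢ fromN ()
other-≢ fromE ()

entry : Tile → Dir → Dir
entry cross d     = d
entry elbow fromN = fromE
entry elbow fromE = fromN

module Pipes (D : Filling) where

  private variable
    a b a₁ b₁ a₂ b₂ x y r r₁ r₂ : ℕ
    d d₁ d₂ : Dir
    t : Tile
    s s₀ s₁ s₂ : Square
    vs vs₁ vs₂ : List Square

  tile-clash : D a b ≡ cross → D a b ≡ elbow → ⊥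
  tile-clash c e with trans (sym c) e
  ... | ()

  data Step : ℕ → ℕ → Dir → List Square → ℕ → Set where
    west  : D a (suc b) ≡ t → Run D a b fromE vs r →
            Step a (suc b) (entry t fromE) ((a , suc b) ∷ vs) r
    south : D a (suc b) ≡ t → Run D (suc a) (suc b) fromN vs r →
            Step a (suc b) (entry t fromN) ((a , suc b) ∷ vs) r

  step : Run D a b d (s ∷ vs) r → Step a b d (s ∷ vs) r
  step (n-cross c R) = south c R
  step (n-elbow e R) = west e R
  step (e-cross c R) = west c R
  step (e-elbow e R) = south e R

  head-is-start : Run D a b d (s ∷ vs) r → s ≡ (a , b)
  head-is-start R with step R
  ... | west _ _  = refl
  ... | south _ _ = refl

  start∈run : Run D a (suc b) d vs r → (a , suc b) ∈ vs
  start∈run (n-cross _ _) = here refl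
  start∈run (n-elbow _ _) = here refl
  start∈run (e-cross _ _) = here refl
  start∈run (e-elbow _ _) = here refl

  start-row≤exit : Run D a b d vs r → a ≤ r
  start-row≤exit exit          = ≤-refl
  start-row≤exit (n-cross _ R) = <⇒≤ (start-row≤exit R)
  start-row≤exit (n-elbow _ R) = start-row≤exit R
  start-row≤exit (e-cross _ R) = start-row≤exit R
  start-row≤exit (e-elbow _ R) = <⇒≤ (start-row≤exit R)

  length-run : Run D a b d vs r → length vs + a ≡ b + r
  length-run exit = refl
  length-run {vs = _ ∷ vs} R with step R
  ... | west _ R'  = cong suc (length-run R')
  ... | south {a = a} _ R' = trans (sym (+-suc (length vs) a)) (length-run R')

  square-row≥start : Run D a b d vs r → (x , y) ∈ vs → a ≤ x
  square-row≥start R (here refl) = ≤-reflexive (cong proj₁ (sym (head-is-start R)))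
  square-row≥start R (there m) with step R
  ... | west _ R'  = square-row≥start R' m
  ... | south _ R' = <⇒≤ (square-row≥start R' m)

  square-level≤start : Run D a b d vs r → (x , y) ∈ vs → y + a ≤ b + x
  tail-level<start : Run D a b d (s ∷ vs) r → (x , y) ∈ vs → suc (y + a) ≤ b + x

  square-level≤start R (here refl) with step R
  ... | west _ _  = ≤-refl
  ... | south _ _ = ≤-refl
  square-level≤start R (there m) = <⇒≤ (tail-level<start R m)

  tail-level<start {x = x} {y = y} R m with step R
  ... | west _ R'  = s≤s (square-level≤start R' m)
  ... | south {a = a} {b = b} _ R' = subst (_≤ suc b + x) (+-suc y a) (square-level≤start R' m)

  start∉tail : Run D a b d (s ∷ vs) r → (a , b) ∉ vs
  start∉tail R m = n≮n _ (tail-level<start R m)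

  record Abreast (vs₁ vs₂ : List Square) (r₁ r₂ : ℕ) : Set where
    constructor abreast
    field
      {row₁ col₁ row₂ col₂} : ℕ
      {dir₁ dir₂}           : Dir
      run₁  : Run D row₁ col₁ dir₁ vs₁ r₁
      run₂  : Run D row₂ col₂ dir₂ vs₂ r₂
      level : col₁ + row₂ ≡ col₂ + row₁
      above : Above row₁ dir₁ row₂ dir₂

  abreast-tails : Run D a₁ b₁ d₁ (s₁ ∷ vs₁) r₁ → Run D a₂ b₂ d₂ (s₂ ∷ vs₂) r₂ →
                  b₁ + a₂ ≡ b₂ + a₁ → a₁ < a₂ → Abreast vs₁ vs₂ r₁ r₂
  abreast-tails R₁ R₂ lvl p with step R₁ | step R₂
  ... | west _ R₁'  | west _ R₂'  = abreast R₁' R₂' (suc-injective lvl) (row< p)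
  ... | west _ R₁'  | south _ R₂' = abreast R₁' R₂' (trans (+-suc _ _) lvl) (row< (m<n⇒m<1+n p))
  ... | south _ R₁' | west _ R₂'  = abreast R₁' R₂' (trans lvl (sym (+-suc _ _))) (above-from-north p)
  ... | south _ R₁' | south _ R₂' =
    abreast R₁' R₂' (cong suc (trans (+-suc _ _) (trans lvl (sym (+-suc _ _))))) (row< (s≤s p))

  start∉run-at-same-level : Run D a₂ b₂ d₂ (s₂ ∷ vs₂) r₂ → b₁ + a₂ ≡ b₂ + a₁ → a₁ ≢ a₂ →
                       (a₁ , b₁) ∉ s₂ ∷ vs₂
  start∉run-at-same-level R₂ lvl a₁≢a₂ (here e) = a₁≢a₂ (cong proj₁ (trans e (head-is-start R₂)))
  start∉run-at-same-level R₂ lvl a₁≢a₂ (there m) = <-irrefl lvl (tail-level<start R₂ m)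

  shared-in-tail : Run D a₁ b₁ d₁ (s₁ ∷ vs₁) r₁ → Run D a₂ b₂ d₂ (s₂ ∷ vs₂) r₂ →
                   b₁ + a₂ ≡ b₂ + a₁ → a₁ ≢ a₂ → s ∈ s₁ ∷ vs₁ → s ∈ s₂ ∷ vs₂ → s ∈ vs₁
  shared-in-tail R₁ R₂ lvl a₁≢a₂ (here refl) m₂ =
    ⊥-elim (start∉run-at-same-level R₂ lvl a₁≢a₂ (subst (_∈ _) (head-is-start R₁) m₂))
  shared-in-tail _ _ _ _ (there m₁) _ = m₁

  nothing-above-exit : Run D a₁ b₁ d₁ vs r → b₁ + a₂ ≡ a₁ → ¬ Above a₁ d₁ a₂ fromE
  nothing-above-exit {b₁ = b₁} {a₂ = a₂} _ lvl (row< p) = <⇒≱ p (subst (a₂ ≤_) lvl (m≤n+m a₂ b₁))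
  nothing-above-exit {b₁ = suc b} {a₂ = a} _ lvl N-E = <-irrefl (sym lvl) (s≤s (m≤n+m a b))

  NoSharedCross : List Square → List Square → Set
  NoSharedCross vs₁ vs₂ = ∀ {s} → s ∈ vs₁ → s ∈ vs₂ → tileAt D s ≡ cross → ⊥

  OnlySharedCross : Square → List Square → List Square → Set
  OnlySharedCross s₀ vs₁ vs₂ = ∀ {s} → s ∈ vs₁ → s ∈ vs₂ → tileAt D s ≡ cross → s ≡ s₀

  exits-ordered : Abreast vs₁ vs₂ r₁ r₂ → NoSharedCross vs₁ vs₂ → r₁ < r₂
  exits-ordered-meet : Run D a b₁ fromN vs₁ r₁ → Run D a b₂ fromE vs₂ r₂ → b₁ ≡ b₂ →
                       NoSharedCross vs₁ vs₂ → r₁ < r₂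

  exits-ordered (abreast exit R₂ _ (row< p)) _ = <-≤-trans p (start-row≤exit R₂)
  exits-ordered (abreast R₁ exit lvl above) _ = ⊥-elim (nothing-above-exit R₁ lvl above)
  exits-ordered {vs₁ = _ ∷ _} {vs₂ = _ ∷ _} (abreast R₁ R₂ lvl (row< p)) H =
    exits-ordered (abreast-tails R₁ R₂ lvl p) (λ m₁ m₂ → H (there m₁) (there m₂))
  exits-ordered {vs₁ = _ ∷ _} {vs₂ = _ ∷ _} (abreast {row₁ = a} R₁ R₂ lvl N-E) H =
    exits-ordered-meet R₁ R₂ (+-cancelʳ-≡ a _ _ lvl) H

  exits-ordered-meet (n-cross c _) (e-cross _ _) refl H = ⊥-elim (H (here refl) (here refl) c)
  exits-ordered-meet (n-elbow _ R₁) (e-elbow _ R₂) refl H =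
    exits-ordered (abreast R₁ R₂ (+-suc _ _) (row< ≤-refl)) (λ m₁ m₂ → H (there m₁) (there m₂))
  exits-ordered-meet (n-cross c _) (e-elbow e _) refl _ = ⊥-elim (tile-clash c e)
  exits-ordered-meet (n-elbow e _) (e-cross c _) refl _ = ⊥-elim (tile-clash c e)

  exits-reversed : Abreast vs₁ vs₂ r₁ r₂ → s₀ ∈ vs₁ → s₀ ∈ vs₂ → tileAt D s₀ ≡ cross →
                   OnlySharedCross s₀ vs₁ vs₂ → r₂ < r₁
  exits-reversed-meet : Run D a b₁ fromN vs₁ r₁ → Run D a b₂ fromE vs₂ r₂ → b₁ ≡ b₂ →
                        s₀ ∈ vs₁ → s₀ ∈ vs₂ → tileAt D s₀ ≡ cross →
                        OnlySharedCross s₀ vs₁ vs₂ → r₂ < r₁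

  exits-reversed {vs₁ = _ ∷ _} {vs₂ = _ ∷ _} (abreast R₁ R₂ lvl (row< p)) m₁ m₂ c U =
    exits-reversed (abreast-tails R₁ R₂ lvl p)
      (shared-in-tail R₁ R₂ lvl (<⇒≢ p) m₁ m₂) (shared-in-tail R₂ R₁ (sym lvl) (>⇒≢ p) m₂ m₁)
      c (λ m₁' m₂' → U (there m₁') (there m₂'))
  exits-reversed {vs₁ = _ ∷ _} {vs₂ = _ ∷ _} (abreast {row₁ = a} R₁ R₂ lvl N-E) m₁ m₂ c U =
    exits-reversed-meet R₁ R₂ (+-cancelʳ-≡ a _ _ lvl) m₁ m₂ c U

  exits-reversed-meet R₁@(n-cross c R₁') (e-cross _ R₂') refl _ _ _ U =
    exits-ordered (abreast R₂' R₁' (+-suc _ _) (row< ≤-refl)) crossed-only-once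
    where
      -- a later common cross would have to be the square just left, which the tail avoids
      crossed-only-once : NoSharedCross _ _
      crossed-only-once m₂ m₁ c' =
        start∉tail R₁ (subst (_∈ _) (trans (U (there m₁) (there m₂) c')
                                           (sym (U (here refl) (here refl) c))) m₁)
  exits-reversed-meet {a = a} {b₁ = b} {s₀ = s₀} (n-elbow e R₁') (e-elbow _ R₂') refl m₁ m₂ c U =
    exits-reversed (abreast R₁' R₂' (+-suc _ _) (row< ≤-refl)) (past-elbow m₁) (past-elbow m₂) c
      (λ m₁' m₂' → U (there m₁') (there m₂'))
    where
      past-elbow : ∀ {vs} → s₀ ∈ (a , b) ∷ vs → s₀ ∈ vs
      past-elbow (here e') = ⊥-elim (tile-clash (subst (λ s → tileAt D s ≡ cross) e' c) e)
      past-elbow (there m)   = m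
  exits-reversed-meet (n-cross c _) (e-elbow e _) refl _ _ _ _ = ⊥-elim (tile-clash c e)
  exits-reversed-meet (n-elbow e _) (e-cross c _) refl _ _ _ _ = ⊥-elim (tile-clash c e)

  -- Reading a pipe backwards is deterministic: the tile fixes where it came from.
  start-unique-by-length : Run D a₁ b₁ d₁ vs₁ r → Run D a₂ b₂ d₂ vs₂ r →
                           length vs₁ ≡ length vs₂ → (a₁ , b₁ , d₁) ≡ (a₂ , b₂ , d₂)
  start-unique-by-length exit exit _ = refl
  start-unique-by-length {vs₁ = []} {vs₂ = _ ∷ _} _ _ ()
  start-unique-by-length {vs₁ = _ ∷ _} {vs₂ = []} _ _ ()
  start-unique-by-length {vs₁ = _ ∷ _} {vs₂ = _ ∷ _} R₁ R₂ e with step R₁ | step R₂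
  ... | west refl R₁' | west refl R₂'
    with refl ← start-unique-by-length R₁' R₂' (suc-injective e) = refl
  ... | south refl R₁' | south refl R₂'
    with refl ← start-unique-by-length R₁' R₂' (suc-injective e) = refl
  ... | west _ R₁' | south _ R₂'
    with () ← start-unique-by-length R₁' R₂' (suc-injective e)
  ... | south _ R₁' | west _ R₂'
    with () ← start-unique-by-length R₁' R₂' (suc-injective e)

  start-unique : Run D a₁ b₁ d₁ vs₁ r → Run D a₂ b₂ d₂ vs₂ r →
                 b₁ + a₂ ≡ b₂ + a₁ → (a₁ , b₁ , d₁) ≡ (a₂ , b₂ , d₂)
  start-unique R₁ R₂ lvl =
    start-unique-by-length R₁ R₂ (equal-levels⇒equal-lengths (length-run R₁) (length-run R₂) lvl)

  -- The part of a run from the first state whose level equals that of the square (x , y).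
  record Advanced (x y a : ℕ) (vs : List Square) (r : ℕ) : Set where
    constructor advanced
    field
      {row col} : ℕ
      {dir}     : Dir
      {rest}    : List Square
      run     : Run D row col dir rest r
      level   : col + x ≡ y + row
      moved   : Above a fromN row dir
      suffix  : ∀ {s} → s ∈ rest → s ∈ vs
      skipped : ∀ {p q} → (p , q) ∈ vs → (p , q) ∈ rest ⊎ y + p < q + x

  advance : Run D a b d vs r → y + a < b + x → x ≤ y + r → Advanced x y a vs r
  advance-from : Run D a₁ b₁ d₁ vs r → Above a fromN a₁ d₁ → y + a₁ ≤ b₁ + x → x ≤ y + r →
                 Advanced x y a vs r

  skip-head : y + a < suc b + x → Advanced x y a vs r → Advanced x y a ((a , suc b) ∷ vs) r
  skip-head lt (advanced R lvl mv sub skp) = advanced R lvl mv (λ m → there (sub m)) λ where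
    (here refl) → inj₂ lt
    (there m)   → skp m

  advance exit lt le = ⊥-elim (<⇒≱ lt le)
  advance {vs = _ ∷ _} {y = y} {x = x} R lt le with step R
  ... | west _ R' = skip-head lt (advance-from R' N-E (s≤s⁻¹ lt) le)
  ... | south {a = a} {b = b} _ R' =
    skip-head lt (advance-from R' (row< ≤-refl) (subst (_≤ suc b + x) (sym (+-suc y a)) lt) le)

  advance-from R above le le' with m≤n⇒m<n∨m≡n le
  ... | inj₂ eq = advanced R (sym eq) above id inj₁
  ... | inj₁ lt with advanced R' lvl mv sub skp ← advance R lt le' =
    advanced R' lvl (above-trans above mv) sub skp

  -- The run of higher level is advanced to the level of the other; start-unique then
  -- identifies the two states.
  common-exit⇒visits : Run D a₁ b₁ fromN vs₁ r → Run D a₂ (suc b₂) d₂ vs₂ r → a₁ ≤ a₂ →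
                       (a₂ , suc b₂) ∈ vs₁
  common-exit⇒visits {a₁ = a₁} {b₁ = b₁} {r = r} {a₂ = a₂} {b₂ = b₂} R₁ R₂ a₁≤a₂
    with <-cmp (suc b₂ + a₁) (b₁ + a₂)
  ... | tri< lower _ _
    with advanced R₁' lvl _ sub _
           ← advance R₁ lower (≤-trans (start-row≤exit R₂) (m≤n+m r (suc b₂)))
    with refl ← start-unique R₁' R₂ lvl = sub (start∈run R₁')
  ... | tri≈ _ same _ with refl ← start-unique R₁ R₂ (sym same) = start∈run R₁
  ... | tri> _ _ higher
    with advanced R₂' lvl moved _ _
           ← advance R₂ higher (≤-trans (start-row≤exit R₁) (m≤n+m r b₁))
    with refl ← start-unique R₂' R₁ lvl with moved
  ...   | row< a₂<a₁ = ⊥-elim (<⇒≱ a₂<a₁ a₁≤a₂)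

  -- The k-pipe is advanced to the level of the entry (1 , j) of the j-pipe.
  crossing-once-swaps : ∀ {j k} → 1 ≤ j → j < k → PipeRun D j vs₁ r₁ → PipeRun D k vs₂ r₂ →
                        s₀ ∈ vs₁ → s₀ ∈ vs₂ → tileAt D s₀ ≡ cross → OnlySharedCross s₀ vs₁ vs₂ →
                        r₂ < r₁
  crossing-once-swaps {r₂ = r₂} {s₀ = p , q} {j = j} 1≤j j<k R₁ R₂ m₁ m₂ c U
    with advanced R₂' lvl moved sub skipped
           ← advance R₂ (+-monoˡ-< 1 j<k) (≤-trans 1≤j (m≤m+n j r₂)) =
    exits-reversed (abreast R₁ R₂' (sym lvl) moved) m₁ (not-skipped (skipped m₂)) c
      (λ m₁' m₂' → U m₁' (sub m₂'))
    where
      not-skipped : (p , q) ∈ _ ⊎ j + p < q + 1 → (p , q) ∈ _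
      not-skipped (inj₁ m) = m
      not-skipped (inj₂ earlier) = ⊥-elim (<⇒≱ earlier (square-level≤start R₁ m₁))

  enters-north⇒column≥1 : Run D a b fromN vs r → 1 ≤ b
  enters-north⇒column≥1 (n-cross _ _) = s≤s z≤n
  enters-north⇒column≥1 (n-elbow _ _) = s≤s z≤n

  run-at : Run D a b d vs r → (x , y) ∈ vs → ∃₂ λ d' vs' → Run D x y d' ((x , y) ∷ vs') r
  run-at R (here refl) with step R
  ... | west _ _  = _ , _ , R
  ... | south _ _ = _ , _ , R
  run-at R (there m) with step R
  ... | west _ R'  = run-at R' m
  ... | south _ R' = run-at R' m

  module _ (N : ℕ) (bounded : ∀ a b → 1 ≤ a → 1 ≤ b → D a b ≡ cross → a ≤ N × b ≤ N) where
    -- The fuel c counts the rows left before row N, below which every tile is an elbow.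
    run-from-north : ∀ b c a → 1 ≤ a → N < c + a → ∃₂ λ vs r → Run D a (suc b) fromN vs r
    run-from-east  : ∀ b c a → 1 ≤ a → N < c + a → ∃₂ λ vs r → Run D a b fromE vs r

    run-from-north b c a 1≤a N<c+a with D a (suc b) in e
    ... | elbow with _ , r , R ← run-from-east b c a 1≤a N<c+a = _ , r , n-elbow e R
    run-from-north b zero a 1≤a N<a | cross =
      ⊥-elim (<⇒≱ N<a (proj₁ (bounded a (suc b) 1≤a (s≤s z≤n) e)))
    run-from-north b (suc c) a 1≤a N<c+a | cross
      with _ , r , R ← run-from-north b c (suc a) (s≤s z≤n) (subst (N <_) (sym (+-suc c a)) N<c+a) =
      _ , r , n-cross e R

    run-from-east zero c a _ _ = [] , a , exit
    run-from-east (suc b) c a 1≤a N<c+a with D a (suc b) in e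
    ... | cross with _ , r , R ← run-from-east b c a 1≤a N<c+a = _ , r , e-cross e R
    ... | elbow
      with _ , r , R ← run-from-north b c (suc a) (s≤s z≤n)
                         (subst (N <_) (sym (+-suc c a)) (m<n⇒m<1+n N<c+a)) =
      _ , r , e-elbow e R

  run-exists : FinitelyManyCrosses D → 1 ≤ a → ∀ d → ∃₂ λ vs r → Run D a (suc b) d vs r
  run-exists {a = a} {b = b} (N , bounded) 1≤a fromN =
    run-from-north N bounded b (suc N) a 1≤a (s≤s (m≤m+n N a))
  run-exists {a = a} {b = b} (N , bounded) 1≤a fromE =
    run-from-east N bounded (suc b) (suc N) a 1≤a (s≤s (m≤m+n N a))

  elbow-staircase : Run D a (suc b) fromN vs r → All (λ s → tileAt D s ≡ elbow) vs →
                    a ≤ x → x + y ≡ a + b → 1 ≤ y → (x , y) ∈ vs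
  elbow-staircase (n-cross c _) (e ∷ _) _ _ _ = ⊥-elim (tile-clash c e)
  elbow-staircase {a = a} {b = zero} (n-elbow _ exit) _ a≤x x+y≡a+0 1≤y =
    ⊥-elim (m+1+n≰m a (subst (a + 1 ≤_) (trans x+y≡a+0 (+-identityʳ a)) (+-mono-≤ a≤x 1≤y)))
  elbow-staircase (n-elbow _ (e-cross c _)) (_ ∷ e ∷ _) _ _ _ = ⊥-elim (tile-clash c e)
  elbow-staircase {a = a} {b = suc b} {x = x} (n-elbow _ (e-elbow _ R)) (_ ∷ _ ∷ elbows)
                  a≤x x+y≡a+b 1≤y with m≤n⇒m<n∨m≡n a≤x
  ... | inj₂ refl = there (here (cong (x ,_) (+-cancelˡ-≡ x _ _ x+y≡a+b)))
  ... | inj₁ a<x  = there (there (elbow-staircase R elbows a<x (trans x+y≡a+b (+-suc a b)) 1≤y))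

Separates : Perm∞ → ℕ → Set
Separates w i = ∀ j → 1 ≤ j → (i < j ⇔ fun w i < fun w j)

injective-bounded⇒≤ : ∀ {n k} (f : ℕ → ℕ) → (∀ {x y} → f x ≡ f y → x ≡ y) →
                      (∀ x → x ≤ n → f x ≤ k) → n ≤ k
injective-bounded⇒≤ {n} {k} f f-injective bounded = s≤s⁻¹ (injective⇒≤ {f = g} g-injective)
  where
    g : Fin (suc n) → Fin (suc k)
    g j = fromℕ< (s≤s (bounded (toℕ j) (toℕ≤pred[n] j)))
    g-injective : ∀ {j₁ j₂} → g j₁ ≡ g j₂ → j₁ ≡ j₂
    g-injective e =
      toℕ-injective (f-injective (trans (sym (toℕ-fromℕ< _)) (trans (cong toℕ e) (toℕ-fromℕ< _))))

module _ (w : Perm∞) where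

  fun-injective : ∀ {x y} → fun w x ≡ fun w y → x ≡ y
  fun-injective {x} {y} e = trans (sym (inv-fun w x)) (trans (cong (inv w) e) (inv-fun w y))

  inv-injective : ∀ {x y} → inv w x ≡ inv w y → x ≡ y
  inv-injective {x} {y} e = trans (sym (fun-inv w x)) (trans (cong (fun w) e) (fun-inv w y))

  -- By the separation, fun w maps [0, i] into [0, fun w i] and inv w maps [0, fun w i] into [0, i].
  separating⇒fixed : ∀ {i} → Separates w i → fun w i ≡ i
  separating⇒fixed {i} sep = ≤-antisym (injective-bounded⇒≤ (inv w) inv-injective inv-bounded)
                                       (injective-bounded⇒≤ (fun w) fun-injective fun-bounded)
    where
      fun-bounded : ∀ x → x ≤ i → fun w x ≤ fun w i
      fun-bounded zero    _   = subst (_≤ fun w i) (sym (fun-0 w)) z≤n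
      fun-bounded (suc x) x≤i = ≮⇒≥ (λ q → <⇒≱ (Equivalence.from (sep (suc x) (s≤s z≤n)) q) x≤i)
      inv-bounded : ∀ m → m ≤ fun w i → inv w m ≤ i
      inv-bounded m m≤wi = ≮⇒≥ λ i<m′ →
        <⇒≱ (subst (fun w i <_) (fun-inv w m)
                   (Equivalence.to (sep (inv w m) (≤-trans (s≤s z≤n) i<m′)) i<m′)) m≤wi

  InS⇒separates : ∀ {n i} → InS n w → n < i → Separates w i
  InS⇒separates {n} {i} w∈Sn n<i j _ with n <? j
  ... | yes n<j = mk⇔ (subst₂ _<_ (sym (w∈Sn i n<i)) (sym (w∈Sn j n<j)))
                      (subst₂ _<_ (w∈Sn i n<i) (w∈Sn j n<j))
  ... | no n≮j = mk⇔ (λ i<j → ⊥-elim (<⇒≱ (<-trans n<i i<j) j≤n))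
                     (λ wi<wj → ⊥-elim (<⇒≱ (<-trans n<i (subst (_< fun w j) (w∈Sn i n<i) wi<wj))
                                            (fun-≤ j≤n)))
    where
      j≤n : j ≤ n
      j≤n = ≮⇒≥ n≮j
      fun-≤ : ∀ {m} → m ≤ n → fun w m ≤ n
      fun-≤ {m} m≤n = ≮⇒≥ λ n<wm → <⇒≱ (subst (n <_) (fun-injective (w∈Sn (fun w m) n<wm)) n<wm) m≤n

separating-pipe-elbows : ∀ {w i D vs} → Separates w i → PipeDreamFor w D → 1 ≤ i →
                         PipeRun D i vs i → All (λ s → tileAt D s ≡ elbow) vs
separating-pipe-elbows {w} {i} {D} {vs} sep (finite , reduced , rows) 1≤i RI = All.tabulate elbow-at
  where
    open Pipes D

    wi≡i : fun w i ≡ i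
    wi≡i = separating⇒fixed w sep

    no-cross : ∀ {x y} → (x , y) ∈ vs → D x y ≢ cross
    no-cross {x} {zero} m _ with _ , _ , () ← run-at RI m
    no-cross {x} {suc y} m c
      with dI , _ , RIs ← run-at RI m
      with _ , rP , RP ← run-exists finite (square-row≥start RI m) (other dI)
      with vsk , Rk ← rows rP (≤-trans (square-row≥start RI m) (start-row≤exit RP))
      = refute (<-cmp (fun w rP) i)
      where
        1≤rP : 1 ≤ rP
        1≤rP = ≤-trans (square-row≥start RI m) (start-row≤exit RP)
        1≤k : 1 ≤ fun w rP
        1≤k = enters-north⇒column≥1 Rk
        s∈k : (x , suc y) ∈ vsk
        s∈k = common-exit⇒visits Rk RP (square-row≥start RI m)
        i≢k : i ≢ fun w rP
        i≢k i≡k = other-≢ dI (cong (λ (_ , _ , d) → d) (start-unique RIs RP′ refl))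
          where
            rP≡i : rP ≡ i
            rP≡i = fun-injective w (trans (sym i≡k) (sym wi≡i))
            RP′ : Run D x (suc y) (other dI) _ i
            RP′ = subst (Run D x (suc y) (other dI) _) rP≡i RP
        only-here : OnlySharedCross (x , suc y) vs vsk
        only-here t∈I t∈k ct = reduced 1≤i 1≤k i≢k RI Rk t∈I t∈k ct m s∈k c
        refute : Tri (fun w rP < i) (fun w rP ≡ i) (i < fun w rP) → ⊥
        refute (tri< k<i _ _) =
          <⇒≱ k<i (<⇒≤ (subst (_< fun w rP) wi≡i (Equivalence.to (sep rP 1≤rP) i<rP)))
          where
            i<rP : i < rP
            i<rP = crossing-once-swaps 1≤k k<i Rk RI s∈k m c (λ t∈k t∈I → only-here t∈I t∈k)
        refute (tri≈ _ k≡i _) = i≢k (sym k≡i)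
        refute (tri> _ _ i<k) =
          <⇒≱ rP<i (<⇒≤ (Equivalence.from (sep rP 1≤rP) (subst (_< fun w rP) (sym wi≡i) i<k)))
          where
            rP<i : rP < i
            rP<i = crossing-once-swaps 1≤i i<k RI Rk m s∈k c only-here

    elbow-at : ∀ {s} → s ∈ vs → tileAt D s ≡ elbow
    elbow-at {x , y} m with D x y in e
    ... | elbow = refl
    ... | cross = ⊥-elim (no-cross m e)

lemma3p1 :
    (∀ (w : Perm∞) (i : ℕ) → 1 ≤ i →
       (∀ j → 1 ≤ j → (i < j ⇔ fun w i < fun w j)) →
       ∀ (D : Filling) → PipeDreamFor w D →
       (∃ λ vs → PipeRun D i vs (fun w i) × All (λ s → tileAt D s ≡ elbow) vs))
    ×
    (∀ (n : ℕ) (w : Perm∞) → InS n w →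
       ∀ (D : Filling) → PipeDreamFor w D →
       ∀ a b → 1 ≤ a → 1 ≤ b → n < a + b → D a b ≡ elbow)
lemma3p1 = separating-pipe , outside-triangle
  where
    separating-pipe : ∀ w i → 1 ≤ i → Separates w i → ∀ D → PipeDreamFor w D →
                      ∃ λ vs → PipeRun D i vs (fun w i) × All (λ s → tileAt D s ≡ elbow) vs
    separating-pipe w i 1≤i sep D pd@(_ , _ , rows) with vs , R ← rows i 1≤i =
      vs , subst (PipeRun D i vs) (sym wi≡i) Rᵢ , separating-pipe-elbows {w = w} sep pd 1≤i Rᵢ
      where
        wi≡i : fun w i ≡ i
        wi≡i = separating⇒fixed w sep
        Rᵢ : PipeRun D i vs i
        Rᵢ = subst (λ k → PipeRun D k vs i) wi≡i R

    outside-triangle : ∀ n w → InS n w → ∀ D → PipeDreamFor w D →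
                       ∀ a b → 1 ≤ a → 1 ≤ b → n < a + b → D a b ≡ elbow
    outside-triangle n w w∈Sn D pd (suc a) b _ 1≤b n<i
      with _ , R , elbows
             ← separating-pipe w (suc a + b) (s≤s z≤n) (InS⇒separates w w∈Sn n<i) D pd =
      All.lookup elbows (Pipes.elbow-staircase D R elbows (s≤s z≤n) refl 1≤b)
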